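{- For every integer $n \ge 3$, we have $\chi'_{st}(C_3 \,\square\, C_n) = 6$ if $n$ is divisible by $3$, and $\chi'_{st}(C_3 \,\square\, C_n) = 7$ otherwise.
   Context: A star edge-coloring of a graph $G$ is a proper edge-coloring of $G$ in which there is no bichromatic path and no bichromatic cycle of length four (i.e., with four edges). The star chromatic index $\chi'_{st}(G)$ is the minimum number of colors in a star edge-coloring of $G$. $C_m$ denotes the cycle on $m$ vertices. $G \,\square\, H$ denotes the Cartesian product: vertex set $V(G)\times V(H)$, with $(u,v)(u',v')$ an edge iff either $uu'\in E(G)$ and $v=v'$, or $u=u'$ and $vv'\in E(H)$. -}

module Defs where

open import Level using (0ℓ)
import Data.Nat
open import Data.Nat using (ℕ; zero; suc; _<_; _≤_; s≤s; z≤n)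
open import Data.Sum using (inj₁; inj₂)
open import Relation.Binary.PropositionalEquality using (refl; sym; trans; cong)
open import Data.Fin using (Fin; toℕ)
open import Data.Product using (_×_; Σ; ∃; _,_)
open import Data.Sum using (_⊎_)
open import Relation.Binary.PropositionalEquality using (_≡_; _≢_)
open import Relation.Nullary using (¬_)
open import Data.Empty using (⊥)

record Graph : Set₁ where
  field
    V      : Set
    Adj    : V → V → Set
    adj-sym : ∀ {u v} → Adj u v → Adj v u
    irrefl : ∀ {u} → ¬ Adj u u
open Graph public

-- An edge-colouring with k colours: a colour for every ordered pair, required
-- to be symmetric on edges (so it is really a colour per edge {u,v});
-- values on non-adjacent pairs are irrelevant.
record EdgeColouring (G : Graph) (k : ℕ) : Set where
  field
    col     : V G → V G → Fin k
    col-sym : ∀ {u v} → Adj G u v → col u v ≡ col v u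
open EdgeColouring public

Proper : {G : Graph} {k : ℕ} → EdgeColouring G k → Set
Proper {G} c = ∀ {u v w} → Adj G u v → Adj G u w → v ≢ w → col c u v ≢ col c u w

BichromaticWalk4 : {G : Graph} {k : ℕ} → EdgeColouring G k →
                   V G → V G → V G → V G → V G → Set
BichromaticWalk4 {G} c v0 v1 v2 v3 v4 =
  Adj G v0 v1 × Adj G v1 v2 × Adj G v2 v3 × Adj G v3 v4 ×
  col c v0 v1 ≡ col c v2 v3 × col c v1 v2 ≡ col c v3 v4

Distinct4 : {A : Set} → A → A → A → A → Set
Distinct4 a b c d = a ≢ b × a ≢ c × a ≢ d × b ≢ c × b ≢ d × c ≢ d

IsPath4 : {A : Set} → A → A → A → A → A → Set
IsPath4 v0 v1 v2 v3 v4 = Distinct4 v0 v1 v2 v3 × v4 ≢ v0 × v4 ≢ v1 × v4 ≢ v2 × v4 ≢ v3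

IsCycle4 : {A : Set} → A → A → A → A → A → Set
IsCycle4 v0 v1 v2 v3 v4 = Distinct4 v0 v1 v2 v3 × v4 ≡ v0

IsStarEdgeColouring : {G : Graph} {k : ℕ} → EdgeColouring G k → Set
IsStarEdgeColouring {G} c =
  Proper c ×
  (∀ v0 v1 v2 v3 v4 → BichromaticWalk4 c v0 v1 v2 v3 v4 →
     ¬ (IsPath4 v0 v1 v2 v3 v4 ⊎ IsCycle4 v0 v1 v2 v3 v4))

StarEdgeColourable : Graph → ℕ → Set
StarEdgeColourable G k = Σ (EdgeColouring G k) IsStarEdgeColouring

StarChromaticIndex≡ : Graph → ℕ → Set
StarChromaticIndex≡ G k = StarEdgeColourable G k × (∀ m → m < k → ¬ StarEdgeColourable G m)

CycAdj : (m : ℕ) → Fin m → Fin m → Set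
CycAdj m i j = Succ i j ⊎ Succ j i
  where
  Succ : Fin m → Fin m → Set
  Succ a b = (suc (toℕ a) ≡ toℕ b) ⊎ (suc (toℕ a) ≡ m × toℕ b ≡ 0)

private
  n≢1+n : ∀ n → n ≡ suc n → ⊥
  n≢1+n zero ()
  n≢1+n (suc n) e = n≢1+n n (cong Data.Nat.pred e)

  wrapImp : ∀ m x → 3 ≤ m → suc x ≡ m → x ≡ 0 → ⊥
  wrapImp .(suc zero) zero (s≤s ()) refl refl
  wrapImp m (suc x) h e ()

  cycAdj-irrefl : (m : ℕ) → 3 ≤ m → ∀ {i : Fin m} → ¬ CycAdj m i i
  cycAdj-irrefl m _ {i} (inj₁ (inj₁ e)) = n≢1+n (toℕ i) (sym e)
  cycAdj-irrefl m _ {i} (inj₂ (inj₁ e)) = n≢1+n (toℕ i) (sym e)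
  cycAdj-irrefl m h {i} (inj₁ (inj₂ (e , z))) = wrapImp m (toℕ i) h e z
  cycAdj-irrefl m h {i} (inj₂ (inj₂ (e , z))) = wrapImp m (toℕ i) h e z

  cycAdj-sym : (m : ℕ) → ∀ {i j : Fin m} → CycAdj m i j → CycAdj m j i
  cycAdj-sym m (inj₁ p) = inj₂ p
  cycAdj-sym m (inj₂ p) = inj₁ p

Cycle : (m : ℕ) → 3 ≤ m → Graph
Cycle m h = record
  { V = Fin m ; Adj = CycAdj m ; adj-sym = cycAdj-sym m ; irrefl = cycAdj-irrefl m h }

_□_ : Graph → Graph → Graph
G □ H = record
  { V = V G × V H
  ; Adj = λ { (u , v) (u' , v') → (Adj G u u' × v ≡ v') ⊎ (u ≡ u' × Adj H v v') }
  ; adj-sym = λ { (inj₁ (a , e)) → inj₁ (adj-sym G a , sym e)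
            ; (inj₂ (e , a)) → inj₂ (sym e , adj-sym H a) }
  ; irrefl = λ { (inj₁ (a , _)) → irrefl G a ; (inj₂ (_ , a)) → irrefl H a }
  }

-- Lower bounds: a star edge-colouring restricts to every window of a few
-- consecutive triangles of C₃ □ Cₙ, whose edges can be numbered once and for
-- all. An exhaustive search over colourings up to renaming of colours, proved
-- sound below, shows that three consecutive triangles need six colours, and that
-- with six colours each triangle carries the colours of the previous one,
-- rotated, and the same colours as the triangle three rows further on. When
-- 3 ∤ n the period 3 along the cycle forces period 1, so the colours are not
-- rotated after all.
--
-- Upper bounds: the colourings are given row by row, a 3-periodic pattern with
-- six colours, preceded by four or five special rows using a seventh colour when
-- n ≡ 1 or 2 (mod 3). Properness and the star condition are local, so it
-- suffices to check all sequences of nine consecutive row types; these are the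
-- walks of length eight in a graph of row types that does not depend on n.

module Submission where

open import Data.Bool using (Bool; true; false; T; _∧_; _∨_; if_then_else_)
open import Data.Bool.ListAction using (all; any)
open import Data.Bool.Properties using (T-∧; T-∨)
open import Data.Empty using (⊥-elim)
open import Data.Fin as Fin using (Fin; zero; suc; toℕ; fromℕ<; inject≤; splitAt; _↑ˡ_; _↑ʳ_)
open import Data.Fin.Patterns using (0F; 1F; 2F; 3F; 4F; 5F)
open import Data.Fin.Properties
  using (_≟_; toℕ-fromℕ<; toℕ-injective; toℕ<n; inject≤-injective; pigeonhole)
  renaming (all? to allFin?)
open import Data.List using (List; []; _∷_; _++_; length; map; lookup; upTo; concatMap)
open import Data.List.Properties using (length-map)
open import Data.List.Membership.Propositional using (_∈_; find)
open import Data.List.Membership.Propositional.Properties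
  using (∈-lookup; ∈-map⁺; ∈-concatMap⁺; ∈-upTo⁺)
open import Data.List.Relation.Unary.All as All using (All; []; _∷_)
open import Data.List.Relation.Unary.All.Properties
  using (all⁺; ¬Any⇒All¬) renaming (map⁺ to All-map⁺)
open import Data.List.Relation.Unary.AllPairs using (AllPairs; []; _∷_)
import Data.List.Relation.Unary.AllPairs.Properties as AllPairs
open import Data.List.Relation.Unary.Any as Any using (Any; here; there; any?)
open import Data.List.Relation.Unary.Any.Properties using (any⁻; ¬Any[])
open import Data.Maybe using (Maybe; just; nothing)
open import Data.Nat as ℕ
  using (ℕ; zero; suc; NonZero; _+_; _*_; _∸_; _<_; _≤_; _≡ᵇ_; _<ᵇ_; _≤?_; _<?_; z≤n; s≤s; s≤s⁻¹)
open import Data.Nat.Properties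
  using ( ≡ᵇ⇒≡; <⇒<ᵇ; ≰⇒>; ≤⇒≯; ≮⇒≥; <⇒≤; <⇒≢; ≤∧≢⇒<; <-cmp; ≤-refl; ≤-reflexive; ≤-trans
        ; ≤-antisym; n≤1+n; m≤n⇒m≤1+n; m≤n⇒m<n∨m≡n; pred[n]≤n; m≤m+n; m≤n+m; +-monoʳ-≤
        ; +-monoʳ-<; +-comm; +-assoc; +-suc; *-suc; m+[n∸m]≡n; m+n∸m≡n)
open import Data.Nat.DivMod
  using ( _%_; _/_; _mod_; m%n<n; m<n⇒m%n≡m; n%n≡0; m%n%n≡m%n; [m+n]%n≡m%n; [m+kn]%n≡m%n
        ; %-distribˡ-+; m≡m%n+[m/n]*n; +-distrib-/-∣ʳ; m<n⇒m/n≡0; m*n/n≡m)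
open import Data.Nat.Divisibility using (_∣_; ∣-refl; n∣m*n; m%n≡0⇒n∣m; n∣m⇒m%n≡0)
open import Data.Nat.GeneralisedArithmetic using (fold; fold-+)
open import Data.Product using (Σ; _×_; _,_; proj₁; proj₂)
import Data.Product.Properties as Product
open import Data.Sum using (_⊎_; inj₁; inj₂)
open import Data.Unit using (⊤; tt)
open import Function using (_∘_; Equivalence)
open import Relation.Nullary using (¬_; Dec; does; yes; no)
open import Relation.Nullary.Decidable
  using (_×-dec_; _⊎-dec_; _→-dec_; ¬?; map′; from-yes; dec-true; dec-false)
open import Relation.Binary.Definitions using (DecidableEquality; tri<; tri≈; tri>)
open import Relation.Binary.PropositionalEquality
open ≡-Reasoning

open import Defs

private
  variable
    A B : Set

-- Arithmetic on the cycle

[1+m%n]%n≡[1+m]%n : ∀ m n .{{_ : NonZero n}} → suc (m % n) % n ≡ suc m % n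
[1+m%n]%n≡[1+m]%n m n = begin
  (1 + m % n) % n           ≡⟨ %-distribˡ-+ 1 (m % n) n ⟩
  (1 % n + m % n % n) % n   ≡⟨ cong (λ t → (1 % n + t) % n) (m%n%n≡m%n m n) ⟩
  (1 % n + m % n) % n       ≡⟨ %-distribˡ-+ 1 m n ⟨
  suc m % n                 ∎

3∤n⇒4≤n : ∀ {n} → 3 ≤ n → ¬ 3 ∣ n → 4 ≤ n
3∤n⇒4≤n 3≤n 3∤n = ≤∧≢⇒< 3≤n (λ 3≡n → 3∤n (subst (3 ∣_) 3≡n ∣-refl))

module Rotation (m : ℕ) where

  N : ℕ
  N = suc m

  next : Fin N → Fin N
  next y = fromℕ< (m%n<n (suc (toℕ y)) N)

  toℕ-next : ∀ y → toℕ (next y) ≡ suc (toℕ y) % N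
  toℕ-next y = toℕ-fromℕ< _

  next^ : ℕ → Fin N → Fin N
  next^ d y = fold y next d

  next^-+ : ∀ d e y → next^ (d + e) y ≡ next^ d (next^ e y)
  next^-+ d e y = fold-+ y next d

  toℕ-next^ : ∀ d y → toℕ (next^ d y) ≡ (d + toℕ y) % N
  toℕ-next^ zero y = sym (m<n⇒m%n≡m (toℕ<n y))
  toℕ-next^ (suc d) y = begin
    toℕ (next (next^ d y))      ≡⟨ toℕ-next (next^ d y) ⟩
    suc (toℕ (next^ d y)) % N   ≡⟨ cong (λ t → suc t % N) (toℕ-next^ d y) ⟩
    suc ((d + toℕ y) % N) % N   ≡⟨ [1+m%n]%n≡[1+m]%n (d + toℕ y) N ⟩
    suc (d + toℕ y) % N         ∎

  next^-N : ∀ y → next^ N y ≡ y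
  next^-N y = toℕ-injective (begin
    toℕ (next^ N y)   ≡⟨ toℕ-next^ N y ⟩
    (N + toℕ y) % N   ≡⟨ cong (_% N) (+-comm N (toℕ y)) ⟩
    (toℕ y + N) % N   ≡⟨ [m+n]%n≡m%n (toℕ y) N ⟩
    toℕ y % N         ≡⟨ m<n⇒m%n≡m (toℕ<n y) ⟩
    toℕ y             ∎)

  next^-*N : ∀ j y → next^ (j * N) y ≡ y
  next^-*N zero y = refl
  next^-*N (suc j) y = begin
    next^ (N + j * N) y       ≡⟨ next^-+ N (j * N) y ⟩
    next^ N (next^ (j * N) y) ≡⟨ next^-N _ ⟩
    next^ (j * N) y           ≡⟨ next^-*N j y ⟩
    y                         ∎

  next^-next : ∀ d y → next^ d (next y) ≡ next (next^ d y)
  next^-next d y = begin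
    next^ d (next y)  ≡⟨ next^-+ d 1 y ⟨
    next^ (d + 1) y   ≡⟨ cong (λ e → next^ e y) (+-comm d 1) ⟩
    next^ (suc d) y   ∎

  next^m-next : ∀ y → next^ m (next y) ≡ y
  next^m-next y = trans (next^-next m y) (next^-N y)

  next-injective : ∀ {y y'} → next y ≡ next y' → y ≡ y'
  next-injective {y} {y'} e = begin
    y                 ≡⟨ next^m-next y ⟨
    next^ m (next y)  ≡⟨ cong (next^ m) e ⟩
    next^ m (next y') ≡⟨ next^m-next y' ⟩
    y'                ∎

  -- The number of steps from x to y; it inverts next^ on offsets below N.
  offset : Fin N → Fin N → ℕ
  offset x y = (toℕ y + (N ∸ toℕ x)) % N

  offset-next^ : ∀ {o} x → o < N → offset x (next^ o x) ≡ o
  offset-next^ {o} x o<N = begin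
    offset x (next^ o x)                    ≡⟨ cong (λ u → (u + (N ∸ t)) % N) (toℕ-next^ o x) ⟩
    ((o + t) % N + (N ∸ t)) % N             ≡⟨ %-distribˡ-+ ((o + t) % N) (N ∸ t) N ⟩
    ((o + t) % N % N + (N ∸ t) % N) % N     ≡⟨ cong (λ u → (u + (N ∸ t) % N) % N) (m%n%n≡m%n (o + t) N) ⟩
    ((o + t) % N + (N ∸ t) % N) % N         ≡⟨ %-distribˡ-+ (o + t) (N ∸ t) N ⟨
    (o + t + (N ∸ t)) % N                   ≡⟨ cong (_% N) (+-assoc o t (N ∸ t)) ⟩
    (o + (t + (N ∸ t))) % N                 ≡⟨ cong (λ u → (o + u) % N) (m+[n∸m]≡n t≤N) ⟩
    (o + N) % N                             ≡⟨ [m+n]%n≡m%n o N ⟩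
    o % N                                   ≡⟨ m<n⇒m%n≡m o<N ⟩
    o                                       ∎
    where
    t = toℕ x
    t≤N = <⇒≤ (toℕ<n x)

  next^-injective : ∀ {o p} x → o < N → p < N → next^ o x ≡ next^ p x → o ≡ p
  next^-injective {o} {p} x o<N p<N e = begin
    o                     ≡⟨ offset-next^ x o<N ⟨
    offset x (next^ o x)  ≡⟨ cong (offset x) e ⟩
    offset x (next^ p x)  ≡⟨ offset-next^ x p<N ⟩
    p                     ∎

  -- The successor relation underlying CycAdj.
  Succ : Fin N → Fin N → Set
  Succ a b = (suc (toℕ a) ≡ toℕ b) ⊎ (suc (toℕ a) ≡ N × toℕ b ≡ 0)

  succ-next : ∀ y → Succ y (next y)
  succ-next y with m≤n⇒m<n∨m≡n (toℕ<n y)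
  ... | inj₁ 1+y<N = inj₁ (sym (trans (toℕ-next y) (m<n⇒m%n≡m 1+y<N)))
  ... | inj₂ 1+y≡N = inj₂ (1+y≡N , trans (toℕ-next y) (trans (cong (_% N) 1+y≡N) (n%n≡0 N)))

  succ⇒next : ∀ {y y'} → Succ y y' → y' ≡ next y
  succ⇒next {y} {y'} (inj₁ e) = toℕ-injective (begin
    toℕ y'             ≡⟨ e ⟨
    suc (toℕ y)        ≡⟨ m<n⇒m%n≡m (subst (_< N) (sym e) (toℕ<n y')) ⟨
    suc (toℕ y) % N    ≡⟨ toℕ-next y ⟨
    toℕ (next y)       ∎)
  succ⇒next {y} {y'} (inj₂ (e , y'≡0)) = toℕ-injective (begin
    toℕ y'             ≡⟨ y'≡0 ⟩
    0                  ≡⟨ n%n≡0 N ⟨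
    N % N              ≡⟨ cong (_% N) e ⟨
    suc (toℕ y) % N    ≡⟨ toℕ-next y ⟨
    toℕ (next y)       ∎)

  adjacent-next : ∀ y → CycAdj N y (next y)
  adjacent-next y = inj₁ (succ-next y)

  cycAdj⇒next : ∀ {y y'} → CycAdj N y y' → y' ≡ next y ⊎ y ≡ next y'
  cycAdj⇒next (inj₁ s) = inj₁ (succ⇒next s)
  cycAdj⇒next (inj₂ s) = inj₂ (succ⇒next s)

  next^-*3-invariant : (f : Fin N → A) → (∀ y → f (next^ 3 y) ≡ f y) →
                       ∀ j y → f (next^ (j * 3) y) ≡ f y
  next^-*3-invariant f period zero y = refl
  next^-*3-invariant f period (suc j) y = begin
    f (next^ (3 + j * 3) y)       ≡⟨ cong f (next^-+ 3 (j * 3) y) ⟩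
    f (next^ 3 (next^ (j * 3) y)) ≡⟨ period _ ⟩
    f (next^ (j * 3) y)           ≡⟨ next^-*3-invariant f period j y ⟩
    f y                           ∎

  -- If N = 3q + 1, one step followed by 3q steps is a full turn; if N = 3q + 2,
  -- 3 (q + 1) steps are a full turn followed by one step.
  period-3⇒period-1 : ¬ 3 ∣ N → (f : Fin N → A) → (∀ y → f (next^ 3 y) ≡ f y) →
                      ∀ y → f (next y) ≡ f y
  period-3⇒period-1 3∤N f period y with N % 3 | m≡m%n+[m/n]*n N 3 | m%n<n N 3 | m%n≡0⇒n∣m N 3
  ... | 0 | _ | _ | 3∣N = ⊥-elim (3∤N (3∣N refl))
  ... | 1 | N≡1+3q | _ | _ = begin
    f (next y)                    ≡⟨ next^-*3-invariant f period (N / 3) (next y) ⟨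
    f (next^ (N / 3 * 3) (next y)) ≡⟨ cong f (next^-+ (N / 3 * 3) 1 y) ⟨
    f (next^ (N / 3 * 3 + 1) y)   ≡⟨ cong (λ d → f (next^ d y)) (trans (+-comm _ 1) (sym N≡1+3q)) ⟩
    f (next^ N y)                 ≡⟨ cong f (next^-N y) ⟩
    f y                           ∎
  ... | 2 | N≡2+3q | _ | _ = begin
    f (next y)                    ≡⟨ cong (f ∘ next) (next^-N y) ⟨
    f (next^ (suc N) y)           ≡⟨ cong (λ d → f (next^ d y)) (cong suc N≡2+3q) ⟩
    f (next^ (suc (N / 3) * 3) y) ≡⟨ next^-*3-invariant f period (suc (N / 3)) y ⟩
    f y                           ∎
  ... | suc (suc (suc _)) | _ | s≤s (s≤s (s≤s ())) | _

  prev^ : ℕ → Fin N → Fin N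
  prev^ d y = next^ (d * m) y

  next^-prev^ : ∀ d y → next^ d (prev^ d y) ≡ y
  next^-prev^ d y = begin
    next^ d (next^ (d * m) y) ≡⟨ next^-+ d (d * m) y ⟨
    next^ (d + d * m) y       ≡⟨ cong (λ e → next^ e y) (*-suc d m) ⟨
    next^ (d * N) y           ≡⟨ next^-*N d y ⟩
    y                         ∎

  next≢ : 1 < N → ∀ y → next y ≢ y
  next≢ 1<N y e with () ← next^-injective y 1<N (s≤s z≤n) e

  next²≢ : 2 < N → ∀ y → next (next y) ≢ y
  next²≢ 2<N y e with () ← next^-injective y 2<N (s≤s z≤n) e

-- Searching colourings

lookupOr : A → List A → ℕ → A
lookupOr d []       _       = d
lookupOr d (a ∷ as) zero    = a
lookupOr d (a ∷ as) (suc i) = lookupOr d as i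

lookupOr-All : ∀ {P : A → Set} {d xs} → P d → All P xs → ∀ i → P (lookupOr d xs i)
lookupOr-All pd []         _       = pd
lookupOr-All pd (px ∷ _)   zero    = px
lookupOr-All pd (_ ∷ pxs)  (suc i) = lookupOr-All pd pxs i

allPairs-lookup : ∀ {R : A → A → Set} {xs : List A} → AllPairs R xs →
                  ∀ {i j} → i Fin.< j → R (lookup xs i) (lookup xs j)
allPairs-lookup (Rx ∷ _)  {zero}  {suc j} _         = All.lookup Rx (∈-lookup j)
allPairs-lookup (_ ∷ Rxs) {suc i} {suc j} (s≤s i<j) = allPairs-lookup Rxs i<j

distinct⇒length≤ : ∀ {k} (xs : List (Fin k)) → AllPairs _≢_ xs → length xs ≤ k
distinct⇒length≤ {k} xs distinct with length xs ≤? k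
... | yes ≤k = ≤k
... | no ≰k with i , j , i<j , same ← pigeonhole (≰⇒> ≰k) (lookup xs) =
  ⊥-elim (allPairs-lookup distinct i<j same)

T-∧⁻ : ∀ {b c} → T (b ∧ c) → T b × T c
T-∧⁻ = Equivalence.to T-∧

-- A pair (i , j) stands for the equation "items i and j have the same colour";
-- a constraint forbids its two equations to hold together.
Constraint : Set
Constraint = (ℕ × ℕ) × (ℕ × ℕ)

module _ {k} (v : ℕ → Fin k) where

  Same : ℕ × ℕ → Set
  Same (i , j) = v i ≡ v j

  Respects : Constraint → Set
  Respects (e , f) = ¬ (Same e × Same f)

-- Backtracking over the colourings of the items 0, 1, 2, … with at most k
-- colours, up to renaming colours: each item takes the colour of an earlier
-- representative item or becomes the representative of a new colour.
-- It succeeds if every such colouring of the first fuel items violates one of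
-- the constraints (constraintsAt x is tested once item x is coloured) or
-- satisfies one of the conjunctions in goal.
module Search (k : ℕ) (constraintsAt : ℕ → List Constraint) (goal : List (List (ℕ × ℕ))) where

  -- (item , representative of its colour), most recent first
  Assignment : Set
  Assignment = List (ℕ × ℕ)

  representative : Assignment → ℕ → Maybe ℕ
  representative []             i = nothing
  representative ((j , r) ∷ σ) i = if i ≡ᵇ j then just r else representative σ i

  sameColour : Assignment → ℕ × ℕ → Bool
  sameColour σ (i , j) with representative σ i | representative σ j
  ... | just r | just s = r ≡ᵇ s
  ... | _      | _      = false

  violated : Assignment → Constraint → Bool
  violated σ (e , f) = sameColour σ e ∧ sameColour σ f

  goalReached : Assignment → Bool
  goalReached σ = any (all (sameColour σ)) goal

  search : (fuel x : ℕ) → Assignment → (reps : List ℕ) → Bool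
  branch : (fuel x : ℕ) → Assignment → (r : ℕ) → (reps : List ℕ) → Bool

  search zero    x σ reps = goalReached σ
  search (suc f) x σ reps =
    all (λ r → branch f x σ r reps) reps ∧
    (if length reps <ᵇ k then branch f x σ x (x ∷ reps) else true)

  branch f x σ r reps =
    any (violated ((x , r) ∷ σ)) (constraintsAt x) ∨ search f (suc x) ((x , r) ∷ σ) reps

  module Sound (v : ℕ → Fin k) where

    Agrees : Assignment → Set
    Agrees = All (Same v)

    DistinctColours : List ℕ → Set
    DistinctColours = AllPairs (λ r s → v r ≢ v s)

    representative-sound : ∀ σ i {r} → Agrees σ → representative σ i ≡ just r → v i ≡ v r
    representative-sound ((j , r) ∷ σ) i (vj≡vr ∷ ag) e with i ≡ᵇ j in i≡ᵇj
    ... | true with refl ← e = trans (cong v (≡ᵇ⇒≡ i j (subst T (sym i≡ᵇj) _))) vj≡vr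
    ... | false = representative-sound σ i ag e

    sameColour-sound : ∀ σ e → Agrees σ → T (sameColour σ e) → Same v e
    sameColour-sound σ (i , j) ag t with representative σ i in ri | representative σ j in rj
    ... | just r | just s = trans (representative-sound σ i ag ri)
                              (trans (cong v (≡ᵇ⇒≡ r s t)) (sym (representative-sound σ j ag rj)))

    module _ (respects : ∀ x → All (Respects v) (constraintsAt x)) where

      unviolated : ∀ σ x → Agrees σ → ¬ T (any (violated σ) (constraintsAt x))
      unviolated σ x ag t with c , c∈ , vc ← find (any⁻ (violated σ) _ t) | c
      ... | e , f = All.lookup (respects x) c∈
                      (sameColour-sound σ e ag (proj₁ (T-∧⁻ vc)) ,
                       sameColour-sound σ f ag (proj₂ (T-∧⁻ vc)))

      goal-sound : ∀ σ → Agrees σ → T (goalReached σ) → Any (All (Same v)) goal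
      goal-sound σ ag t = Any.map (All.map (sameColour-sound σ _ ag) ∘ all⁺ _ _) (any⁻ _ goal t)

      search-sound : ∀ fuel x σ reps → Agrees σ → DistinctColours reps →
                     T (search fuel x σ reps) → Any (All (Same v)) goal
      branch-sound : ∀ fuel x σ r reps → Agrees ((x , r) ∷ σ) → DistinctColours reps →
                     T (branch fuel x σ r reps) → Any (All (Same v)) goal

      search-sound zero x σ reps ag d t = goal-sound σ ag t
      search-sound (suc f) x σ reps ag d t with any? (λ r → v x ≟ v r) reps
      ... | yes old with r , r∈reps , vx≡vr ← find old =
        branch-sound f x σ r reps (vx≡vr ∷ ag) d (All.lookup (all⁺ _ reps (proj₁ (T-∧⁻ t))) r∈reps)
      ... | no new with length reps <ᵇ k in room
      ...   | true  =
        branch-sound f x σ x (x ∷ reps) (refl ∷ ag) (¬Any⇒All¬ reps new ∷ d) (proj₂ (T-∧⁻ t))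
      ...   | false = ⊥-elim (subst T room (<⇒<ᵇ fewer))
        where
        -- x and the representatives have pairwise distinct colours
        fewer : length reps < k
        fewer = subst (_≤ k) (length-map v (x ∷ reps))
                  (distinct⇒length≤ (map v (x ∷ reps)) (AllPairs.map⁺ (¬Any⇒All¬ reps new ∷ d)))

      branch-sound f x σ r reps ag d b with Equivalence.to T-∨ b
      ... | inj₁ bad = ⊥-elim (unviolated ((x , r) ∷ σ) x ag bad)
      ... | inj₂ ok  = search-sound f (suc x) ((x , r) ∷ σ) reps ag d ok

-- Windows of consecutive rows

module _ (_≟_ : DecidableEquality A) where

  distinct4? : ∀ a b c d → Dec (Distinct4 a b c d)
  distinct4? a b c d =
    ¬? (a ≟ b) ×-dec ¬? (a ≟ c) ×-dec ¬? (a ≟ d) ×-dec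
    ¬? (b ≟ c) ×-dec ¬? (b ≟ d) ×-dec ¬? (c ≟ d)

  pathOrCycle4? : ∀ a b c d e → Dec (IsPath4 a b c d e ⊎ IsCycle4 a b c d e)
  pathOrCycle4? a b c d e =
    (distinct4? a b c d ×-dec ¬? (e ≟ a) ×-dec ¬? (e ≟ b) ×-dec ¬? (e ≟ c) ×-dec ¬? (e ≟ d))
    ⊎-dec (distinct4? a b c d ×-dec (e ≟ a))

module _ {P : A → Set} (f : A → B) (injective : ∀ {a b} → P a → P b → f a ≡ f b → a ≡ b) where

  ≢-map : ∀ {a b} → P a → P b → a ≢ b → f a ≢ f b
  ≢-map pa pb a≢b = a≢b ∘ injective pa pb

  distinct4-map : ∀ {a b c d} → P a → P b → P c → P d →
                  Distinct4 a b c d → Distinct4 (f a) (f b) (f c) (f d)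
  distinct4-map pa pb pc pd (ab , ac , ad , bc , bd , cd) =
    ≢-map pa pb ab , ≢-map pa pc ac , ≢-map pa pd ad ,
    ≢-map pb pc bc , ≢-map pb pd bd , ≢-map pc pd cd

  pathOrCycle4-map : ∀ {a b c d e} → P a → P b → P c → P d → P e →
                     IsPath4 a b c d e ⊎ IsCycle4 a b c d e →
                     IsPath4 (f a) (f b) (f c) (f d) (f e) ⊎ IsCycle4 (f a) (f b) (f c) (f d) (f e)
  pathOrCycle4-map pa pb pc pd pe (inj₁ (dist , ea , eb , ec , ed)) =
    inj₁ (distinct4-map pa pb pc pd dist ,
          ≢-map pe pa ea , ≢-map pe pb eb , ≢-map pe pc ec , ≢-map pe pd ed)
  pathOrCycle4-map pa pb pc pd pe (inj₂ (dist , e≡a)) =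
    inj₂ (distinct4-map pa pb pc pd dist , cong f e≡a)

starEdgeColourable-mono : ∀ {G k k′} → k ≤ k′ → StarEdgeColourable G k → StarEdgeColourable G k′
starEdgeColourable-mono {G} {k} {k′} k≤k′ (c , proper , star) = c′ , proper′ , star′
  where
  c′ : EdgeColouring G k′
  c′ = record { col     = λ u v → inject≤ (col c u v) k≤k′
              ; col-sym = λ adj → cong (λ i → inject≤ i k≤k′) (col-sym c adj) }
  reflect : ∀ {i j} → inject≤ i k≤k′ ≡ inject≤ j k≤k′ → i ≡ j
  reflect = inject≤-injective k≤k′ k≤k′ _ _
  proper′ : Proper c′
  proper′ uv uw v≢w same = proper uv uw v≢w (reflect same)
  star′ : ∀ v₀ v₁ v₂ v₃ v₄ → BichromaticWalk4 c′ v₀ v₁ v₂ v₃ v₄ →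
          ¬ (IsPath4 v₀ v₁ v₂ v₃ v₄ ⊎ IsCycle4 v₀ v₁ v₂ v₃ v₄)
  star′ v₀ v₁ v₂ v₃ v₄ (a₀₁ , a₁₂ , a₂₃ , a₃₄ , e₀₂ , e₁₃) =
    star v₀ v₁ v₂ v₃ v₄ (a₀₁ , a₁₂ , a₂₃ , a₃₄ , reflect e₀₂ , reflect e₁₃)

3≤3 : 3 ≤ 3
3≤3 = s≤s (s≤s (s≤s z≤n))

Torus₃ : (m : ℕ) → 3 ≤ suc m → Graph
Torus₃ m h = Cycle 3 3≤3 □ Cycle (suc m) h

rot rot⁻¹ : Fin 3 → Fin 3
rot 0F = 1F
rot 1F = 2F
rot 2F = 0F
rot⁻¹ 0F = 2F
rot⁻¹ 1F = 0F
rot⁻¹ 2F = 1F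

rot-rot⁻¹ : ∀ a → rot (rot⁻¹ a) ≡ a
rot-rot⁻¹ 0F = refl
rot-rot⁻¹ 1F = refl
rot-rot⁻¹ 2F = refl

rot⁻¹-rot : ∀ a → rot⁻¹ (rot a) ≡ a
rot⁻¹-rot 0F = refl
rot⁻¹-rot 1F = refl
rot⁻¹-rot 2F = refl

rot≡next : ∀ a → rot a ≡ Rotation.next 2 a
rot≡next 0F = refl
rot≡next 1F = refl
rot≡next 2F = refl

adjacent-rot : ∀ a → CycAdj 3 a (rot a)
adjacent-rot a = subst (CycAdj 3 a) (sym (rot≡next a)) (Rotation.adjacent-next 2 a)

adjacent-rot⁻¹ : ∀ a → CycAdj 3 a (rot⁻¹ a)
adjacent-rot⁻¹ a =
  adj-sym (Cycle 3 3≤3) (subst (CycAdj 3 (rot⁻¹ a)) (rot-rot⁻¹ a) (adjacent-rot (rot⁻¹ a)))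

triangleAdj⇒rot : ∀ {a b} → CycAdj 3 a b → b ≡ rot a ⊎ b ≡ rot⁻¹ a
triangleAdj⇒rot {a} {b} adj with Rotation.cycAdj⇒next 2 adj
... | inj₁ b≡next = inj₁ (trans b≡next (sym (rot≡next a)))
... | inj₂ a≡next = inj₂ (begin
  b                 ≡⟨ rot⁻¹-rot b ⟨
  rot⁻¹ (rot b)     ≡⟨ cong rot⁻¹ (trans (rot≡next b) (sym a≡next)) ⟩
  rot⁻¹ a           ∎)

-- A vertex of a window of consecutive rows: a triangle vertex and the number of
-- rows it lies beyond the first row of the window.
Pos : Set
Pos = Fin 3 × ℕ

_≟ₚ_ : DecidableEquality Pos
_≟ₚ_ = Product.≡-dec _≟_ ℕ._≟_

data Move : Set where
  fwd bwd up down : Move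

step : Pos → Move → Pos
step (a , o) fwd  = rot a , o
step (a , o) bwd  = rot⁻¹ a , o
step (a , o) up   = a , suc o
step (a , o) down = a , ℕ.pred o

-- Each row owns six edges: slot a ↑ˡ 3 is the triangle edge {a, rot a},
-- slot 3 ↑ʳ a the edge from a to the following row.
edgeRow : Pos → Move → ℕ
edgeRow (_ , o) down = ℕ.pred o
edgeRow (_ , o) _    = o

edgeSlot : Fin 3 → Move → Fin 6
edgeSlot a fwd  = a ↑ˡ 3
edgeSlot a bwd  = rot⁻¹ a ↑ˡ 3
edgeSlot a up   = 3 ↑ʳ a
edgeSlot a down = 3 ↑ʳ a

edgeIndex : Pos → Move → ℕ
edgeIndex (a , o) mv = toℕ (edgeSlot a mv) + edgeRow (a , o) mv * 6

InWindow : ℕ → Pos → Set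
InWindow W (_ , o) = o < W

-- Moving down from row 0 has no target in the window.
Admissible : Pos → Move → Set
Admissible (_ , o) down = 0 < o
Admissible _       _    = ⊤

admissible? : ∀ w mv → Dec (Admissible w mv)
admissible? (_ , o) fwd  = yes tt
admissible? (_ , o) bwd  = yes tt
admissible? (_ , o) up   = yes tt
admissible? (_ , o) down = 0 ℕ.<? o

edgeRow≤ : ∀ w mv → edgeRow w mv ≤ proj₂ w
edgeRow≤ (_ , o) fwd  = ≤-refl
edgeRow≤ (_ , o) bwd  = ≤-refl
edgeRow≤ (_ , o) up   = ≤-refl
edgeRow≤ (_ , o) down = pred[n]≤n

Legal : ℕ → Pos → Move → Set
Legal W w mv = Admissible w mv × InWindow W (step w mv)

legal? : ∀ W w mv → Dec (Legal W w mv)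
legal? W w mv = admissible? w mv ×-dec (proj₂ (step w mv) ℕ.<? W)

-- Configurations a star edge-colouring must avoid: two edges at a vertex, or
-- a walk of length four that is a path or a 4-cycle.
data Conflict : Set where
  fork : Pos → Move → Move → Conflict
  walk : Pos → Move → Move → Move → Move → Conflict

-- A fork is the constraint "not (e₁ = e₂ and e₁ = e₁)".
constraintOf : Conflict → Constraint
constraintOf (fork w m₁ m₂) = (edgeIndex w m₁ , edgeIndex w m₂) , (edgeIndex w m₁ , edgeIndex w m₁)
constraintOf (walk w₀ m₁ m₂ m₃ m₄) =
  let w₁ = step w₀ m₁ ; w₂ = step w₁ m₂ ; w₃ = step w₂ m₃ in
  (edgeIndex w₀ m₁ , edgeIndex w₂ m₃) , (edgeIndex w₁ m₂ , edgeIndex w₃ m₄)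

Valid : ℕ → Conflict → Set
Valid W (fork w m₁ m₂) = Legal W w m₁ × Legal W w m₂ × step w m₁ ≢ step w m₂
Valid W (walk w₀ m₁ m₂ m₃ m₄) =
  let w₁ = step w₀ m₁ ; w₂ = step w₁ m₂ ; w₃ = step w₂ m₃ ; w₄ = step w₃ m₄ in
  InWindow W w₀ × Legal W w₀ m₁ × Legal W w₁ m₂ × Legal W w₂ m₃ × Legal W w₃ m₄ ×
  (IsPath4 w₀ w₁ w₂ w₃ w₄ ⊎ IsCycle4 w₀ w₁ w₂ w₃ w₄)

valid? : ∀ W cf → Dec (Valid W cf)
valid? W (fork w m₁ m₂) =
  legal? W w m₁ ×-dec legal? W w m₂ ×-dec ¬? (step w m₁ ≟ₚ step w m₂)
valid? W (walk w₀ m₁ m₂ m₃ m₄) =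
  let w₁ = step w₀ m₁ ; w₂ = step w₁ m₂ ; w₃ = step w₂ m₃ ; w₄ = step w₃ m₄ in
  (proj₂ w₀ ℕ.<? W) ×-dec
  legal? W w₀ m₁ ×-dec legal? W w₁ m₂ ×-dec legal? W w₂ m₃ ×-dec legal? W w₃ m₄ ×-dec
  pathOrCycle4? _≟ₚ_ w₀ w₁ w₂ w₃ w₄

module Embedding (m : ℕ) (h : 3 ≤ suc m) (x : Fin (suc m)) where
  open Rotation m

  embed : Pos → Fin 3 × Fin N
  embed (a , o) = a , next^ o x

  embed-adjacent : ∀ w mv → Admissible w mv → Adj (Torus₃ m h) (embed w) (embed (step w mv))
  embed-adjacent (a , o)     fwd  _ = inj₁ (adjacent-rot a , refl)
  embed-adjacent (a , o)     bwd  _ = inj₁ (adjacent-rot⁻¹ a , refl)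
  embed-adjacent (a , o)     up   _ = inj₂ (refl , adjacent-next (next^ o x))
  embed-adjacent (a , suc o) down _ = inj₂ (refl , adj-sym (Cycle N h) (adjacent-next (next^ o x)))

  embed-injective : ∀ {W} → W ≤ N → ∀ {w w′} → InWindow W w → InWindow W w′ →
                    embed w ≡ embed w′ → w ≡ w′
  embed-injective W≤N {_ , o} {_ , o′} o<W o′<W e =
    cong₂ _,_ (cong proj₁ e) (next^-injective x (≤-trans o<W W≤N) (≤-trans o′<W W≤N) (cong proj₂ e))

  neighbour-step : ∀ {w u} → 0 < proj₂ w → Adj (Torus₃ m h) (embed w) u →
                   Σ Move λ mv → u ≡ embed (step w mv)
  neighbour-step {a , suc o} _ (inj₁ (adj , e)) with triangleAdj⇒rot adj
  ... | inj₁ refl = fwd , cong (rot a ,_) (sym e)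
  ... | inj₂ refl = bwd , cong (rot⁻¹ a ,_) (sym e)
  neighbour-step {a , suc o} _ (inj₂ (refl , adj)) with cycAdj⇒next adj
  ... | inj₁ y≡next = up , cong (a ,_) y≡next
  ... | inj₂ next≡  = down , cong (a ,_) (sym (next-injective next≡))

module Reading (m : ℕ) (h : 3 ≤ suc m) {k} (c : EdgeColouring (Torus₃ m h) k) (x : Fin (suc m)) where
  open Rotation m
  open Embedding m h x

  slotColour : Fin N → Fin 6 → Fin k
  slotColour y 0F = col c (0F , y) (1F , y)
  slotColour y 1F = col c (1F , y) (2F , y)
  slotColour y 2F = col c (2F , y) (0F , y)
  slotColour y 3F = col c (0F , y) (0F , next y)
  slotColour y 4F = col c (1F , y) (1F , next y)
  slotColour y 5F = col c (2F , y) (2F , next y)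

  colourOf : ℕ → Fin k
  colourOf i = slotColour (next^ (i / 6) x) (i mod 6)

  colourOf-index : ∀ (j : Fin 6) o → colourOf (toℕ j + o * 6) ≡ slotColour (next^ o x) j
  colourOf-index j o = cong₂ slotColour (cong (λ r → next^ r x) row) slot
    where
    row : (toℕ j + o * 6) / 6 ≡ o
    row = begin
      (toℕ j + o * 6) / 6   ≡⟨ +-distrib-/-∣ʳ (toℕ j) (n∣m*n o) ⟩
      toℕ j / 6 + o * 6 / 6 ≡⟨ cong₂ _+_ (m<n⇒m/n≡0 (toℕ<n j)) (m*n/n≡m o 6) ⟩
      o                     ∎
    slot : (toℕ j + o * 6) mod 6 ≡ j
    slot = toℕ-injective (begin
      toℕ ((toℕ j + o * 6) mod 6) ≡⟨ toℕ-fromℕ< _ ⟩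
      (toℕ j + o * 6) % 6         ≡⟨ [m+kn]%n≡m%n (toℕ j) o 6 ⟩
      toℕ j % 6                   ≡⟨ m<n⇒m%n≡m (toℕ<n j) ⟩
      toℕ j                       ∎)

  slotColour-triangle : ∀ y a → slotColour y (a ↑ˡ 3) ≡ col c (a , y) (rot a , y)
  slotColour-triangle y 0F = refl
  slotColour-triangle y 1F = refl
  slotColour-triangle y 2F = refl

  slotColour-vertical : ∀ y a → slotColour y (3 ↑ʳ a) ≡ col c (a , y) (a , next y)
  slotColour-vertical y 0F = refl
  slotColour-vertical y 1F = refl
  slotColour-vertical y 2F = refl

  colour-embed : ∀ w mv → Admissible w mv →
                 col c (embed w) (embed (step w mv)) ≡ colourOf (edgeIndex w mv)
  colour-embed (a , o) fwd _ = begin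
    col c (a , y) (rot a , y)                   ≡⟨ slotColour-triangle y a ⟨
    slotColour y (a ↑ˡ 3)                       ≡⟨ colourOf-index (a ↑ˡ 3) o ⟨
    colourOf (edgeIndex (a , o) fwd)            ∎
    where y = next^ o x
  colour-embed (a , o) bwd l = begin
    col c (a , y) (rot⁻¹ a , y)                 ≡⟨ col-sym c (embed-adjacent (a , o) bwd l) ⟩
    col c (rot⁻¹ a , y) (a , y)                 ≡⟨ cong (λ b → col c (rot⁻¹ a , y) (b , y)) (rot-rot⁻¹ a) ⟨
    col c (rot⁻¹ a , y) (rot (rot⁻¹ a) , y)     ≡⟨ slotColour-triangle y (rot⁻¹ a) ⟨
    slotColour y (rot⁻¹ a ↑ˡ 3)                 ≡⟨ colourOf-index (rot⁻¹ a ↑ˡ 3) o ⟨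
    colourOf (edgeIndex (a , o) bwd)            ∎
    where y = next^ o x
  colour-embed (a , o) up _ = begin
    col c (a , y) (a , next y)                  ≡⟨ slotColour-vertical y a ⟨
    slotColour y (3 ↑ʳ a)                       ≡⟨ colourOf-index (3 ↑ʳ a) o ⟨
    colourOf (edgeIndex (a , o) up)             ∎
    where y = next^ o x
  colour-embed (a , suc o) down l = begin
    col c (a , next y) (a , y)                  ≡⟨ col-sym c (embed-adjacent (a , suc o) down l) ⟩
    col c (a , y) (a , next y)                  ≡⟨ slotColour-vertical y a ⟨
    slotColour y (3 ↑ʳ a)                       ≡⟨ colourOf-index (3 ↑ʳ a) o ⟨
    colourOf (edgeIndex (a , suc o) down)       ∎
    where y = next^ o x

  valid⇒respects : ∀ {W} → W ≤ N → IsStarEdgeColouring c →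
                   ∀ cf → Valid W cf → Respects colourOf (constraintOf cf)
  valid⇒respects {W} W≤N (proper , _) (fork w m₁ m₂) ((a₁ , w₁∈) , (a₂ , w₂∈) , w₁≢w₂) (same , _) =
    proper (embed-adjacent w m₁ a₁) (embed-adjacent w m₂ a₂)
      (≢-map {P = InWindow W} embed (embed-injective W≤N) w₁∈ w₂∈ w₁≢w₂)
      (trans (colour-embed w m₁ a₁) (trans same (sym (colour-embed w m₂ a₂))))
  valid⇒respects {W} W≤N (_ , star) (walk w₀ m₁ m₂ m₃ m₄)
                 (w₀∈ , (a₁ , w₁∈) , (a₂ , w₂∈) , (a₃ , w₃∈) , (a₄ , w₄∈) , shape) (same₁₃ , same₂₄) =
    star (embed w₀) (embed w₁) (embed w₂) (embed w₃) (embed w₄)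
      (embed-adjacent w₀ m₁ a₁ , embed-adjacent w₁ m₂ a₂ ,
       embed-adjacent w₂ m₃ a₃ , embed-adjacent w₃ m₄ a₄ ,
       trans (colour-embed w₀ m₁ a₁) (trans same₁₃ (sym (colour-embed w₂ m₃ a₃))) ,
       trans (colour-embed w₁ m₂ a₂) (trans same₂₄ (sym (colour-embed w₃ m₄ a₄))))
      (pathOrCycle4-map {P = InWindow W} embed (embed-injective W≤N) w₀∈ w₁∈ w₂∈ w₃∈ w₄∈ shape)
    where
    w₁ = step w₀ m₁
    w₂ = step w₁ m₂
    w₃ = step w₂ m₃
    w₄ = step w₃ m₄

-- Lower bounds

constraintsFrom : List (List Conflict) → ℕ → List Constraint
constraintsFrom cfs i = map constraintOf (lookupOr [] cfs i)

-- The i-th list holds the conflicts tested once edge i is coloured, in windows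
-- of three and four rows; only their validity matters for soundness.
conflicts₃ : List (List Conflict)
conflicts₃ =
    []
  ∷ ( fork (1F , 0) bwd fwd ∷ [] )
  ∷ ( fork (0F , 0) bwd fwd ∷ fork (2F , 0) bwd fwd ∷ [] )
  ∷ ( fork (0F , 0) fwd up ∷ fork (0F , 0) bwd up ∷ [] )
  ∷ ( walk (0F , 1) down bwd bwd up ∷ fork (1F , 0) fwd up ∷ fork (1F , 0) bwd up ∷ [] )
  ∷ ( walk (0F , 1) down fwd fwd up ∷ walk (1F , 1) down bwd bwd up ∷ fork (2F , 0) fwd up ∷
      fork (2F , 0) bwd up ∷ [] )
  ∷ ( walk (0F , 0) fwd up bwd down ∷ walk (0F , 0) bwd bwd up bwd ∷ walk (0F , 0) up fwd down fwd ∷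
      walk (0F , 1) fwd down fwd up ∷ walk (0F , 1) fwd down bwd bwd ∷ fork (0F , 1) down fwd ∷
      walk (1F , 0) fwd fwd up fwd ∷ walk (1F , 0) up bwd down bwd ∷ walk (1F , 1) bwd down fwd fwd ∷
      walk (1F , 1) bwd down bwd up ∷ fork (1F , 1) down bwd ∷ [] )
  ∷ ( walk (0F , 0) fwd fwd up bwd ∷ walk (0F , 0) fwd up fwd down ∷ walk (0F , 0) bwd bwd up fwd ∷
      walk (0F , 0) bwd up bwd bwd ∷ walk (0F , 0) bwd up bwd down ∷ walk (0F , 0) up fwd fwd down ∷
      walk (0F , 1) fwd fwd down bwd ∷ walk (0F , 1) down fwd up fwd ∷ walk (0F , 1) down bwd up bwd ∷
      walk (1F , 0) fwd up bwd down ∷ walk (1F , 0) bwd bwd up bwd ∷ walk (1F , 0) bwd up fwd fwd ∷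
      fork (1F , 1) bwd fwd ∷ fork (1F , 1) down fwd ∷ walk (2F , 0) fwd fwd up fwd ∷
      walk (2F , 0) fwd up fwd fwd ∷ fork (2F , 1) down bwd ∷ [] )
  ∷ ( walk (0F , 0) fwd fwd up fwd ∷ walk (0F , 0) fwd up fwd fwd ∷ walk (0F , 0) fwd up bwd bwd ∷
      walk (0F , 0) bwd up fwd fwd ∷ walk (0F , 0) bwd up fwd down ∷ walk (0F , 0) up bwd bwd down ∷
      walk (0F , 0) up bwd down bwd ∷ walk (0F , 1) bwd bwd down fwd ∷ walk (0F , 1) bwd down fwd fwd ∷
      walk (0F , 1) bwd down bwd up ∷ fork (0F , 1) bwd fwd ∷ fork (0F , 1) down bwd ∷
      walk (1F , 0) fwd fwd up bwd ∷ walk (1F , 0) fwd up fwd fwd ∷ walk (1F , 0) bwd up bwd bwd ∷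
      walk (1F , 0) bwd up bwd down ∷ walk (1F , 0) up bwd bwd down ∷ walk (1F , 1) fwd fwd down bwd ∷
      walk (1F , 1) down bwd up bwd ∷ walk (2F , 0) bwd bwd up bwd ∷ walk (2F , 0) bwd up bwd bwd ∷
      fork (2F , 1) bwd fwd ∷ fork (2F , 1) down fwd ∷ [] )
  ∷ ( walk (0F , 0) fwd up bwd up ∷ walk (0F , 0) bwd up fwd up ∷ fork (0F , 1) fwd up ∷
      fork (0F , 1) bwd up ∷ fork (0F , 1) down up ∷ walk (0F , 2) down fwd fwd down ∷
      walk (0F , 2) down fwd down fwd ∷ walk (0F , 2) down bwd bwd down ∷ walk (0F , 2) down bwd down bwd ∷
      walk (0F , 2) down down fwd fwd ∷ walk (0F , 2) down down fwd up ∷ walk (0F , 2) down down bwd bwd ∷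
      walk (0F , 2) down down bwd up ∷ [] )
  ∷ ( walk (0F , 0) bwd bwd up up ∷ walk (0F , 0) bwd up bwd up ∷ walk (0F , 0) up bwd bwd up ∷
      walk (0F , 1) down fwd up up ∷ walk (0F , 2) down bwd bwd up ∷ walk (1F , 0) fwd up bwd up ∷
      walk (1F , 0) bwd up fwd up ∷ fork (1F , 1) fwd up ∷ fork (1F , 1) bwd up ∷ fork (1F , 1) down up ∷
      walk (1F , 2) down bwd bwd down ∷ walk (1F , 2) down bwd down bwd ∷ walk (1F , 2) down down fwd up ∷
      walk (1F , 2) down down bwd bwd ∷ [] )
  ∷ ( walk (0F , 0) fwd fwd up up ∷ walk (0F , 0) fwd up fwd up ∷ walk (0F , 0) up fwd fwd up ∷
      walk (0F , 1) down bwd up up ∷ walk (0F , 2) down fwd fwd up ∷ walk (1F , 0) bwd bwd up up ∷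
      walk (1F , 0) bwd up bwd up ∷ walk (1F , 0) up bwd bwd up ∷ walk (1F , 1) down fwd up up ∷
      walk (1F , 2) down bwd bwd up ∷ walk (2F , 0) fwd up bwd up ∷ walk (2F , 0) bwd up fwd up ∷
      fork (2F , 1) fwd up ∷ fork (2F , 1) bwd up ∷ fork (2F , 1) down up ∷ [] )
  ∷ ( walk (0F , 0) fwd up up bwd ∷ walk (0F , 0) up fwd up bwd ∷ walk (0F , 0) up up fwd down ∷
      walk (0F , 1) fwd up bwd down ∷ walk (0F , 1) bwd bwd up bwd ∷ walk (0F , 1) up fwd down fwd ∷
      walk (0F , 1) up fwd down down ∷ walk (0F , 2) fwd down fwd up ∷ walk (0F , 2) fwd down fwd down ∷
      walk (0F , 2) fwd down bwd bwd ∷ walk (0F , 2) fwd down down fwd ∷ fork (0F , 2) down fwd ∷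
      walk (1F , 0) bwd up up fwd ∷ walk (1F , 0) up bwd up fwd ∷ walk (1F , 1) fwd fwd up fwd ∷
      walk (1F , 1) up bwd down bwd ∷ walk (1F , 2) bwd down fwd fwd ∷ walk (1F , 2) bwd down bwd up ∷
      walk (1F , 2) bwd down bwd down ∷ walk (1F , 2) bwd down down bwd ∷ fork (1F , 2) down bwd ∷ [] )
  ∷ ( walk (0F , 0) fwd up up fwd ∷ walk (0F , 0) bwd up up bwd ∷ walk (0F , 0) up fwd up fwd ∷
      walk (0F , 0) up bwd up bwd ∷ walk (0F , 0) up up fwd fwd ∷ walk (0F , 1) fwd fwd up bwd ∷
      walk (0F , 1) fwd up fwd down ∷ walk (0F , 1) bwd bwd up fwd ∷ walk (0F , 1) bwd up bwd bwd ∷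
      walk (0F , 1) bwd up bwd down ∷ walk (0F , 1) up fwd fwd down ∷ walk (0F , 2) fwd fwd down bwd ∷
      walk (0F , 2) fwd fwd down down ∷ walk (0F , 2) down fwd up fwd ∷ walk (0F , 2) down bwd up bwd ∷
      walk (1F , 0) fwd up up bwd ∷ walk (1F , 0) up fwd up bwd ∷ walk (1F , 0) up up fwd down ∷
      walk (1F , 1) fwd up bwd down ∷ walk (1F , 1) bwd bwd up bwd ∷ walk (1F , 1) bwd up fwd fwd ∷
      walk (1F , 1) up fwd down down ∷ fork (1F , 2) bwd fwd ∷ fork (1F , 2) down fwd ∷
      walk (2F , 0) bwd up up fwd ∷ walk (2F , 0) up bwd up fwd ∷ walk (2F , 1) fwd fwd up fwd ∷
      walk (2F , 1) fwd up fwd fwd ∷ fork (2F , 2) down bwd ∷ [] )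
  ∷ ( walk (0F , 0) bwd up up fwd ∷ walk (0F , 0) up bwd up fwd ∷ walk (0F , 0) up up bwd bwd ∷
      walk (0F , 0) up up bwd down ∷ walk (0F , 1) fwd fwd up fwd ∷ walk (0F , 1) fwd up fwd fwd ∷
      walk (0F , 1) fwd up bwd bwd ∷ walk (0F , 1) bwd up fwd fwd ∷ walk (0F , 1) bwd up fwd down ∷
      walk (0F , 1) up bwd bwd down ∷ walk (0F , 1) up bwd down bwd ∷ walk (0F , 1) up bwd down down ∷
      walk (0F , 2) bwd bwd down fwd ∷ walk (0F , 2) bwd bwd down down ∷ walk (0F , 2) bwd down fwd fwd ∷
      walk (0F , 2) bwd down bwd up ∷ walk (0F , 2) bwd down bwd down ∷ walk (0F , 2) bwd down down bwd ∷
      fork (0F , 2) bwd fwd ∷ fork (0F , 2) down bwd ∷ walk (1F , 0) bwd up up bwd ∷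
      walk (1F , 0) up bwd up bwd ∷ walk (1F , 0) up up bwd bwd ∷ walk (1F , 1) fwd fwd up bwd ∷
      walk (1F , 1) fwd up fwd fwd ∷ walk (1F , 1) bwd up bwd bwd ∷ walk (1F , 1) bwd up bwd down ∷
      walk (1F , 1) up bwd bwd down ∷ walk (1F , 2) fwd fwd down bwd ∷ walk (1F , 2) bwd bwd down down ∷
      walk (1F , 2) down bwd up bwd ∷ walk (2F , 0) fwd up up bwd ∷ walk (2F , 0) up fwd up bwd ∷
      walk (2F , 1) bwd bwd up bwd ∷ walk (2F , 1) bwd up bwd bwd ∷ fork (2F , 2) bwd fwd ∷
      fork (2F , 2) down fwd ∷ [] )
  ∷ []

conflicts₄ : List (List Conflict)
conflicts₄ = conflicts₃ ++
    ( walk (0F , 1) fwd up bwd up ∷ walk (0F , 1) bwd up fwd up ∷ fork (0F , 2) fwd up ∷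
      fork (0F , 2) bwd up ∷ fork (0F , 2) down up ∷ walk (0F , 3) down fwd fwd down ∷
      walk (0F , 3) down fwd down fwd ∷ walk (0F , 3) down fwd down down ∷ walk (0F , 3) down bwd bwd down ∷
      walk (0F , 3) down bwd down bwd ∷ walk (0F , 3) down bwd down down ∷ walk (0F , 3) down down fwd fwd ∷
      walk (0F , 3) down down fwd up ∷ walk (0F , 3) down down fwd down ∷ walk (0F , 3) down down bwd bwd ∷
      walk (0F , 3) down down bwd up ∷ walk (0F , 3) down down bwd down ∷ walk (0F , 3) down down down fwd ∷
      walk (0F , 3) down down down bwd ∷ [] )
  ∷ ( walk (0F , 0) fwd up up up ∷ walk (0F , 0) up fwd up up ∷ walk (0F , 0) up up fwd up ∷
      walk (0F , 1) bwd bwd up up ∷ walk (0F , 1) bwd up bwd up ∷ walk (0F , 1) up bwd bwd up ∷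
      walk (0F , 2) down fwd up up ∷ walk (0F , 3) down bwd bwd up ∷ walk (1F , 1) fwd up bwd up ∷
      walk (1F , 1) bwd up fwd up ∷ fork (1F , 2) fwd up ∷ fork (1F , 2) bwd up ∷ fork (1F , 2) down up ∷
      walk (1F , 3) down fwd down down ∷ walk (1F , 3) down bwd bwd down ∷ walk (1F , 3) down bwd down bwd ∷
      walk (1F , 3) down down fwd up ∷ walk (1F , 3) down down fwd down ∷ walk (1F , 3) down down bwd bwd ∷
      walk (1F , 3) down down down fwd ∷ [] )
  ∷ ( walk (0F , 0) bwd up up up ∷ walk (0F , 0) up bwd up up ∷ walk (0F , 0) up up bwd up ∷
      walk (0F , 1) fwd fwd up up ∷ walk (0F , 1) fwd up fwd up ∷ walk (0F , 1) up fwd fwd up ∷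
      walk (0F , 2) down bwd up up ∷ walk (0F , 3) down fwd fwd up ∷ walk (1F , 0) fwd up up up ∷
      walk (1F , 0) up fwd up up ∷ walk (1F , 0) up up fwd up ∷ walk (1F , 1) bwd bwd up up ∷
      walk (1F , 1) bwd up bwd up ∷ walk (1F , 1) up bwd bwd up ∷ walk (1F , 2) down fwd up up ∷
      walk (1F , 3) down bwd bwd up ∷ walk (2F , 1) fwd up bwd up ∷ walk (2F , 1) bwd up fwd up ∷
      fork (2F , 2) fwd up ∷ fork (2F , 2) bwd up ∷ fork (2F , 2) down up ∷ [] )
  ∷ ( walk (0F , 0) up up up fwd ∷ walk (0F , 1) fwd up up bwd ∷ walk (0F , 1) up fwd up bwd ∷
      walk (0F , 1) up up fwd down ∷ walk (0F , 2) fwd up bwd down ∷ walk (0F , 2) bwd bwd up bwd ∷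
      walk (0F , 2) up fwd down fwd ∷ walk (0F , 2) up fwd down down ∷ walk (0F , 3) fwd down fwd up ∷
      walk (0F , 3) fwd down fwd down ∷ walk (0F , 3) fwd down bwd bwd ∷ walk (0F , 3) fwd down down fwd ∷
      walk (0F , 3) fwd down down down ∷ fork (0F , 3) down fwd ∷ walk (1F , 1) bwd up up fwd ∷
      walk (1F , 1) up bwd up fwd ∷ walk (1F , 2) fwd fwd up fwd ∷ walk (1F , 2) up bwd down bwd ∷
      walk (1F , 3) bwd down fwd fwd ∷ walk (1F , 3) bwd down bwd up ∷ walk (1F , 3) bwd down bwd down ∷
      walk (1F , 3) bwd down down bwd ∷ fork (1F , 3) down bwd ∷ [] )
  ∷ ( walk (0F , 1) fwd up up fwd ∷ walk (0F , 1) bwd up up bwd ∷ walk (0F , 1) up fwd up fwd ∷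
      walk (0F , 1) up bwd up bwd ∷ walk (0F , 1) up up fwd fwd ∷ walk (0F , 2) fwd fwd up bwd ∷
      walk (0F , 2) fwd up fwd down ∷ walk (0F , 2) bwd bwd up fwd ∷ walk (0F , 2) bwd up bwd bwd ∷
      walk (0F , 2) bwd up bwd down ∷ walk (0F , 2) up fwd fwd down ∷ walk (0F , 3) fwd fwd down bwd ∷
      walk (0F , 3) fwd fwd down down ∷ walk (0F , 3) down fwd up fwd ∷ walk (0F , 3) down bwd up bwd ∷
      walk (1F , 0) up up up fwd ∷ walk (1F , 1) fwd up up bwd ∷ walk (1F , 1) up fwd up bwd ∷
      walk (1F , 1) up up fwd down ∷ walk (1F , 2) fwd up bwd down ∷ walk (1F , 2) bwd bwd up bwd ∷
      walk (1F , 2) bwd up fwd fwd ∷ walk (1F , 2) up fwd down down ∷ walk (1F , 3) fwd down down down ∷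
      fork (1F , 3) bwd fwd ∷ fork (1F , 3) down fwd ∷ walk (2F , 1) bwd up up fwd ∷
      walk (2F , 1) up bwd up fwd ∷ walk (2F , 2) fwd fwd up fwd ∷ walk (2F , 2) fwd up fwd fwd ∷
      fork (2F , 3) down bwd ∷ [] )
  ∷ ( walk (0F , 0) up up up bwd ∷ walk (0F , 1) bwd up up fwd ∷ walk (0F , 1) up bwd up fwd ∷
      walk (0F , 1) up up bwd bwd ∷ walk (0F , 1) up up bwd down ∷ walk (0F , 2) fwd fwd up fwd ∷
      walk (0F , 2) fwd up fwd fwd ∷ walk (0F , 2) fwd up bwd bwd ∷ walk (0F , 2) bwd up fwd fwd ∷
      walk (0F , 2) bwd up fwd down ∷ walk (0F , 2) up bwd bwd down ∷ walk (0F , 2) up bwd down bwd ∷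
      walk (0F , 2) up bwd down down ∷ walk (0F , 3) bwd bwd down fwd ∷ walk (0F , 3) bwd bwd down down ∷
      walk (0F , 3) bwd down fwd fwd ∷ walk (0F , 3) bwd down bwd up ∷ walk (0F , 3) bwd down bwd down ∷
      walk (0F , 3) bwd down down bwd ∷ walk (0F , 3) bwd down down down ∷ fork (0F , 3) bwd fwd ∷
      fork (0F , 3) down bwd ∷ walk (1F , 1) bwd up up bwd ∷ walk (1F , 1) up bwd up bwd ∷
      walk (1F , 1) up up bwd bwd ∷ walk (1F , 2) fwd fwd up bwd ∷ walk (1F , 2) fwd up fwd fwd ∷
      walk (1F , 2) bwd up bwd bwd ∷ walk (1F , 2) bwd up bwd down ∷ walk (1F , 2) up bwd bwd down ∷
      walk (1F , 3) fwd fwd down bwd ∷ walk (1F , 3) bwd bwd down down ∷ walk (1F , 3) down bwd up bwd ∷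
      walk (2F , 1) fwd up up bwd ∷ walk (2F , 1) up fwd up bwd ∷ walk (2F , 2) bwd bwd up bwd ∷
      walk (2F , 2) bwd up bwd bwd ∷ fork (2F , 3) bwd fwd ∷ fork (2F , 3) down fwd ∷ [] )
  ∷ []

conflicts₃-valid : All (All (Valid 3)) conflicts₃
conflicts₃-valid = from-yes (All.all? (All.all? (valid? 3)) conflicts₃)

conflicts₄-valid : All (All (Valid 4)) conflicts₄
conflicts₄-valid = from-yes (All.all? (All.all? (valid? 4)) conflicts₄)

module _ (m : ℕ) (h : 3 ≤ suc m) {k} (c : EdgeColouring (Torus₃ m h) k) (star : IsStarEdgeColouring c)
         (x : Fin (suc m)) where
  open Reading m h c x

  -- A window of W rows has 6 W - 3 edges.
  window-search : ∀ {W} → W ≤ suc m → (cfs : List (List Conflict)) → All (All (Valid W)) cfs →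
                  ∀ goal fuel → T (Search.search k (constraintsFrom cfs) goal fuel 0 [] []) →
                  Any (All (Same colourOf)) goal
  window-search W≤N cfs valid goal fuel =
    Search.Sound.search-sound k (constraintsFrom cfs) goal colourOf respects fuel 0 [] [] [] []
    where
    respects : ∀ i → All (Respects colourOf) (constraintsFrom cfs i)
    respects i = All-map⁺ (All.map (λ {cf} → valid⇒respects W≤N star cf) (lookupOr-All [] valid i))

no-5-colouring : ∀ m h → ¬ StarEdgeColourable (Torus₃ m h) 5
no-5-colouring m h (c , star) = ¬Any[] (window-search m h c star 0F h conflicts₃ conflicts₃-valid [] 15 _)

module SixColours (m : ℕ) (h : 3 ≤ suc m) (c : EdgeColouring (Torus₃ m h) 6) (star : IsStarEdgeColouring c)
  where
  open Rotation m

  triangle : Fin N → Fin 6 × Fin 6 × Fin 6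
  triangle y = col c (0F , y) (1F , y) , col c (1F , y) (2F , y) , col c (2F , y) (0F , y)

  -- Edges 18, 19 and 20 form the triangle of row 3.
  triangle-period-3 : 4 ≤ N → ∀ y → triangle (next^ 3 y) ≡ triangle y
  triangle-period-3 4≤N y
    with here (e₀ ∷ e₁ ∷ e₂ ∷ []) ← window-search m h c star y 4≤N conflicts₄ conflicts₄-valid
                                       (((0 , 18) ∷ (1 , 19) ∷ (2 , 20) ∷ []) ∷ []) 21 _
    = sym (cong₂ _,_ e₀ (cong₂ _,_ e₁ e₂))

  -- Edges 6, 7 and 8 form the triangle of row 1: it repeats the colours of the
  -- triangle of row 0, rotated; unrotated, two edges at one vertex would agree.
  triangle-next≢ : ∀ y → triangle (next y) ≢ triangle y
  triangle-next≢ y same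
    with window-search m h c star y h conflicts₃ conflicts₃-valid
           (((6 , 1) ∷ (7 , 2) ∷ (8 , 0) ∷ []) ∷ ((6 , 2) ∷ (7 , 0) ∷ (8 , 1) ∷ []) ∷ []) 15 _
  ... | here (e₆₁ ∷ _) =
    proj₁ star (inj₁ (adjacent-rot⁻¹ 1F , refl)) (inj₁ (adjacent-rot 1F , refl)) (λ ()) (begin
      col c (1F , y) (0F , y)             ≡⟨ col-sym c (inj₁ (adjacent-rot⁻¹ 1F , refl)) ⟩
      col c (0F , y) (1F , y)             ≡⟨ cong proj₁ same ⟨
      col c (0F , next y) (1F , next y)   ≡⟨ e₆₁ ⟩
      col c (1F , y) (2F , y)             ∎)
  ... | there (here (e₆₂ ∷ _)) =
    proj₁ star (inj₁ (adjacent-rot 0F , refl)) (inj₁ (adjacent-rot⁻¹ 0F , refl)) (λ ()) (begin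
      col c (0F , y) (1F , y)             ≡⟨ cong proj₁ same ⟨
      col c (0F , next y) (1F , next y)   ≡⟨ e₆₂ ⟩
      col c (2F , y) (0F , y)             ≡⟨ col-sym c (inj₁ (adjacent-rot 2F , refl)) ⟩
      col c (0F , y) (2F , y)             ∎)

no-6-colouring : ∀ m h → ¬ 3 ∣ suc m → ¬ StarEdgeColourable (Torus₃ m h) 6
no-6-colouring m h 3∤N (c , star) =
  triangle-next≢ 0F (period-3⇒period-1 3∤N triangle (triangle-period-3 (3∤n⇒4≤n h 3∤N)) 0F)
  where
  open SixColours m h c star
  open Rotation m using (period-3⇒period-1)

-- Colourings given row by row

allMoves? : {P : Move → Set} → (∀ mv → Dec (P mv)) → Dec (∀ mv → P mv)
allMoves? P? = map′ (λ { (p , q , r , s) → λ { fwd → p ; bwd → q ; up → r ; down → s } })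
                    (λ f → f fwd , f bwd , f up , f down)
                    (P? fwd ×-dec P? bwd ×-dec P? up ×-dec P? down)

-- The local shape of a path or a 4-cycle a b c d e, which is all that survives
-- in a window that may wrap around the cycle.
Simple4 : A → A → A → A → A → Set
Simple4 a b c d e = Distinct4 a b c d × e ≢ b × e ≢ c × e ≢ d

pathOrCycle⇒simple4 : ∀ {a b c d e : A} → IsPath4 a b c d e ⊎ IsCycle4 a b c d e → Simple4 a b c d e
pathOrCycle⇒simple4 (inj₁ (dist , _ , eb , ec , ed)) = dist , eb , ec , ed
pathOrCycle⇒simple4 (inj₂ (dist@(ab , ac , ad , _) , refl)) = dist , ab , ac , ad

simple4-unmap : (f : A → B) {a b c d e : A} {a′ b′ c′ d′ e′ : B} →
                a′ ≡ f a → b′ ≡ f b → c′ ≡ f c → d′ ≡ f d → e′ ≡ f e →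
                Simple4 a′ b′ c′ d′ e′ → Simple4 a b c d e
simple4-unmap f refl refl refl refl refl ((ab , ac , ad , bc , bd , cd) , eb , ec , ed) =
  (ab ∘ cong f , ac ∘ cong f , ad ∘ cong f , bc ∘ cong f , bd ∘ cong f , cd ∘ cong f) ,
  eb ∘ cong f , ec ∘ cong f , ed ∘ cong f

-- A colouring given row by row: L s j is the colour of slot j in a row of type s.
module WindowCheck {k} (L : ℕ → Fin 6 → Fin k) where

  localColour : List ℕ → Pos → Move → Fin k
  localColour ws w mv = L (lookupOr 0 ws (edgeRow w mv)) (edgeSlot (proj₁ w) mv)

  -- Walks of length four from row 4 stay within the nine rows 0 … 8 of a window.
  ProperAt : List ℕ → Set
  ProperAt ws = ∀ a m₁ m₂ → let w = (a , 4) in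
    step w m₁ ≢ step w m₂ → localColour ws w m₁ ≢ localColour ws w m₂

  StarAt : List ℕ → Set
  StarAt ws = ∀ a m₁ m₂ m₃ →
    let w₀ = (a , 4) ; w₁ = step w₀ m₁ ; w₂ = step w₁ m₂ ; w₃ = step w₂ m₃ in
    localColour ws w₀ m₁ ≡ localColour ws w₂ m₃ → ∀ m₄ →
    localColour ws w₁ m₂ ≡ localColour ws w₃ m₄ → ¬ Simple4 w₀ w₁ w₂ w₃ (step w₃ m₄)

  WindowOK : List ℕ → Set
  WindowOK ws = ProperAt ws × StarAt ws

  windowOK? : ∀ ws → Dec (WindowOK ws)
  windowOK? ws = proper? ×-dec star?
    where
    proper? : Dec (ProperAt ws)
    proper? = allFin? λ a → allMoves? λ m₁ → allMoves? λ m₂ →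
      ¬? (step (a , 4) m₁ ≟ₚ step (a , 4) m₂) →-dec
      ¬? (localColour ws (a , 4) m₁ ≟ localColour ws (a , 4) m₂)
    star? : Dec (StarAt ws)
    star? = allFin? λ a → allMoves? λ m₁ → allMoves? λ m₂ → allMoves? λ m₃ →
      let w₀ = (a , 4) ; w₁ = step w₀ m₁ ; w₂ = step w₁ m₂ ; w₃ = step w₂ m₃ in
      (localColour ws w₀ m₁ ≟ localColour ws w₂ m₃) →-dec allMoves? λ m₄ →
      (localColour ws w₁ m₂ ≟ localColour ws w₃ m₄) →-dec
      ¬? (simple4? w₀ w₁ w₂ w₃ (step w₃ m₄))
      where
      simple4? : ∀ a b c d e → Dec (Simple4 a b c d e)
      simple4? a b c d e =
        distinct4? _≟ₚ_ a b c d ×-dec ¬? (e ≟ₚ b) ×-dec ¬? (e ≟ₚ c) ×-dec ¬? (e ≟ₚ d)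

paths : (ℕ → List ℕ) → ℕ → ℕ → List (List ℕ)
paths succs zero    s = (s ∷ []) ∷ []
paths succs (suc l) s = concatMap (λ t → map (s ∷_) (paths succs l t)) (succs s)

-- The slot of the triangle edge {a, b}; junk when a ≡ b.
triangleSlot : Fin 3 → Fin 3 → Fin 6
triangleSlot 0F 1F = 0F
triangleSlot 1F 0F = 0F
triangleSlot 1F 2F = 1F
triangleSlot 2F 1F = 1F
triangleSlot 2F 0F = 2F
triangleSlot 0F 2F = 2F
triangleSlot _  _  = 0F

triangleSlot-sym : ∀ a b → triangleSlot a b ≡ triangleSlot b a
triangleSlot-sym 0F 0F = refl
triangleSlot-sym 0F 1F = refl
triangleSlot-sym 0F 2F = refl
triangleSlot-sym 1F 0F = refl
triangleSlot-sym 1F 1F = refl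
triangleSlot-sym 1F 2F = refl
triangleSlot-sym 2F 0F = refl
triangleSlot-sym 2F 1F = refl
triangleSlot-sym 2F 2F = refl

triangleSlot-fwd : ∀ a → triangleSlot a (rot a) ≡ edgeSlot a fwd
triangleSlot-fwd 0F = refl
triangleSlot-fwd 1F = refl
triangleSlot-fwd 2F = refl

triangleSlot-bwd : ∀ a → triangleSlot a (rot⁻¹ a) ≡ edgeSlot a bwd
triangleSlot-bwd 0F = refl
triangleSlot-bwd 1F = refl
triangleSlot-bwd 2F = refl

Inside : ℕ → Pos → Set
Inside d (_ , o) = d ≤ o × d + o ≤ 8

inside-step : ∀ {d} w mv → Inside (suc d) w → Inside d (step w mv)
inside-step (a , o)     fwd  (l , h) = <⇒≤ l , <⇒≤ h
inside-step (a , o)     bwd  (l , h) = <⇒≤ l , <⇒≤ h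
inside-step {d} (a , o) up   (l , h) = m≤n⇒m≤1+n (<⇒≤ l) , ≤-trans (≤-reflexive (+-suc d o)) h
inside-step {d} (a , suc o) down (l , h) = s≤s⁻¹ l , ≤-trans (+-monoʳ-≤ d (n≤1+n o)) (<⇒≤ h)

inside⇒admissible : ∀ {d} w mv → Inside (suc d) w → Admissible w mv
inside⇒admissible (a , o)     fwd  _ = tt
inside⇒admissible (a , o)     bwd  _ = tt
inside⇒admissible (a , o)     up   _ = tt
inside⇒admissible (a , suc o) down _ = s≤s z≤n

inside⇒edgeRow≤8 : ∀ {d} w mv → Inside (suc d) w → edgeRow w mv ≤ 8
inside⇒edgeRow≤8 {d} (a , o) mv (_ , h) = ≤-trans (edgeRow≤ (a , o) mv) (≤-trans (m≤n+m o (suc d)) h)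

-- Row y of Torus₃ m h has type q y.
module RowColouring (m : ℕ) (h : 3 ≤ suc m) {k} (L : ℕ → Fin 6 → Fin k) (q : Fin (suc m) → ℕ) where
  open Rotation m
  open WindowCheck L

  G : Graph
  G = Torus₃ m h

  1<N : 1 < N
  1<N = ≤-trans (s≤s (s≤s z≤n)) h

  -- junk on non-adjacent pairs
  colour : Fin 3 × Fin N → Fin 3 × Fin N → Fin k
  colour (a , y) (b , y′) with y ≟ y′
  ... | yes _ = L (q y) (triangleSlot a b)
  ... | no _ with y′ ≟ next y
  ...   | yes _ = L (q y) (3 ↑ʳ a)
  ...   | no _  = L (q y′) (3 ↑ʳ a)

  colour-row : ∀ a b y → colour (a , y) (b , y) ≡ L (q y) (triangleSlot a b)
  colour-row a b y with y ≟ y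
  ... | yes _ = refl
  ... | no y≢y = ⊥-elim (y≢y refl)

  colour-up : ∀ a y → colour (a , y) (a , next y) ≡ L (q y) (3 ↑ʳ a)
  colour-up a y with y ≟ next y
  ... | yes y≡next = ⊥-elim (next≢ 1<N y (sym y≡next))
  ... | no _ with next y ≟ next y
  ...   | yes _ = refl
  ...   | no ≢ = ⊥-elim (≢ refl)

  colour-down : ∀ a y → colour (a , next y) (a , y) ≡ L (q y) (3 ↑ʳ a)
  colour-down a y with next y ≟ y
  ... | yes next≡y = ⊥-elim (next≢ 1<N y next≡y)
  ... | no _ with y ≟ next (next y)
  ...   | yes y≡next² = ⊥-elim (next²≢ h y (sym y≡next²))
  ...   | no _ = refl

  colour-sym : ∀ {u v} → Adj G u v → colour u v ≡ colour v u
  colour-sym {a , y} {b , .y} (inj₁ (_ , refl)) = begin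
    colour (a , y) (b , y)   ≡⟨ colour-row a b y ⟩
    L (q y) (triangleSlot a b)    ≡⟨ cong (L (q y)) (triangleSlot-sym a b) ⟩
    L (q y) (triangleSlot b a)    ≡⟨ colour-row b a y ⟨
    colour (b , y) (a , y)   ∎
  colour-sym {a , y} {.a , y′} (inj₂ (refl , adj)) with cycAdj⇒next adj
  ... | inj₁ refl = trans (colour-up a y) (sym (colour-down a y))
  ... | inj₂ refl = trans (colour-down a y′) (sym (colour-up a y′))

  colouring : EdgeColouring G k
  colouring = record { col = colour ; col-sym = colour-sym }

  rowTypes : ℕ → Fin N → List ℕ
  rowTypes zero    z = q z ∷ []
  rowTypes (suc l) z = q z ∷ rowTypes l (next z)

  rowTypes-lookup : ∀ l o z → o ≤ l → lookupOr 0 (rowTypes l z) o ≡ q (next^ o z)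
  rowTypes-lookup zero    zero    z _         = refl
  rowTypes-lookup (suc l) zero    z _         = refl
  rowTypes-lookup (suc l) (suc o) z (s≤s o≤l) =
    trans (rowTypes-lookup l o (next z) o≤l) (cong q (next^-next o z))

  rowTypes∈paths : ∀ {succs} → (∀ y → q (next y) ∈ succs (q y)) →
                   ∀ l z → rowTypes l z ∈ paths succs l (q z)
  rowTypes∈paths next∈ zero    z = here refl
  rowTypes∈paths next∈ (suc l) z =
    ∈-concatMap⁺ _ (Any.map (λ { refl → ∈-map⁺ (q z ∷_) (rowTypes∈paths next∈ l (next z)) }) (next∈ z))

  module E (z : Fin N) = Embedding m h z
  open E using (embed)

  colour-embed : ∀ z w mv → Admissible w mv → edgeRow w mv ≤ 8 →
                 colour (embed z w) (embed z (step w mv)) ≡ localColour (rowTypes 8 z) w mv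
  colour-embed z (a , o) fwd _ r≤8 =
    trans (colour-row a (rot a) (next^ o z)) (cong₂ L (sym (rowTypes-lookup 8 o z r≤8)) (triangleSlot-fwd a))
  colour-embed z (a , o) bwd _ r≤8 =
    trans (colour-row a (rot⁻¹ a) (next^ o z)) (cong₂ L (sym (rowTypes-lookup 8 o z r≤8)) (triangleSlot-bwd a))
  colour-embed z (a , o) up _ r≤8 =
    trans (colour-up a (next^ o z)) (cong (λ s → L s (3 ↑ʳ a)) (sym (rowTypes-lookup 8 o z r≤8)))
  colour-embed z (a , suc o) down _ r≤8 =
    trans (colour-down a (next^ o z)) (cong (λ s → L s (3 ↑ʳ a)) (sym (rowTypes-lookup 8 o z r≤8)))

  inside-colour : ∀ {d} z w mv → Inside (suc d) w →
                  colour (embed z w) (embed z (step w mv)) ≡ localColour (rowTypes 8 z) w mv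
  inside-colour z w mv i = colour-embed z w mv (inside⇒admissible w mv i) (inside⇒edgeRow≤8 w mv i)

  lift : ∀ {d} z w {v u} → Inside (suc d) w → v ≡ embed z w → Adj G v u →
         Σ Move λ mv → u ≡ embed z (step w mv)
  lift z w (l , _) refl = E.neighbour-step z (≤-trans (s≤s z≤n) l)

  local-colours : ∀ {d e} {z} w mv w′ mv′ {v₁ v₂ v₃ v₄} → Inside (suc d) w → Inside (suc e) w′ →
                  v₁ ≡ embed z w → v₂ ≡ embed z (step w mv) →
                  v₃ ≡ embed z w′ → v₄ ≡ embed z (step w′ mv′) → colour v₁ v₂ ≡ colour v₃ v₄ →
                  localColour (rowTypes 8 z) w mv ≡ localColour (rowTypes 8 z) w′ mv′
  local-colours {z = z} w mv w′ mv′ i i′ refl refl refl refl same =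
    trans (sym (inside-colour z w mv i)) (trans same (inside-colour z w′ mv′ i′))

  centre-inside : ∀ a → Inside 4 (a , 4)
  centre-inside a = ≤-refl , ≤-refl

  -- Every vertex is the middle vertex (a , 4) of some window.
  centred : {P : Fin 3 × Fin N → Set} → (∀ z a → P (embed z (a , 4))) → ∀ v → P v
  centred {P} p (a , y) = subst P (cong (a ,_) (next^-prev^ 4 y)) (p (prev^ 4 y) a)

  module _ (ok : ∀ z → WindowOK (rowTypes 8 z)) where

    proper : Proper colouring
    proper {v} =
      centred {P = λ v → ∀ {u₁ u₂} → Adj G v u₁ → Adj G v u₂ → u₁ ≢ u₂ → colour v u₁ ≢ colour v u₂}
              proper-centre v
      where
      proper-centre : ∀ z a {u₁ u₂} → Adj G (embed z (a , 4)) u₁ → Adj G (embed z (a , 4)) u₂ →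
                      u₁ ≢ u₂ → colour (embed z (a , 4)) u₁ ≢ colour (embed z (a , 4)) u₂
      proper-centre z a adj₁ adj₂ u₁≢u₂ same =
        proj₁ (ok z) a m₁ m₂ (λ e → u₁≢u₂ (trans u₁≡ (trans (cong (embed z) e) (sym u₂≡))))
          (local-colours w m₁ w m₂ (centre-inside a) (centre-inside a) refl u₁≡ refl u₂≡ same)
        where
        w = (a , 4)
        m₁ = proj₁ (lift z w (centre-inside a) refl adj₁)
        u₁≡ = proj₂ (lift z w (centre-inside a) refl adj₁)
        m₂ = proj₁ (lift z w (centre-inside a) refl adj₂)
        u₂≡ = proj₂ (lift z w (centre-inside a) refl adj₂)

    star : ∀ v₀ v₁ v₂ v₃ v₄ → BichromaticWalk4 colouring v₀ v₁ v₂ v₃ v₄ →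
           ¬ (IsPath4 v₀ v₁ v₂ v₃ v₄ ⊎ IsCycle4 v₀ v₁ v₂ v₃ v₄)
    star v₀ =
      centred {P = λ v₀ → ∀ v₁ v₂ v₃ v₄ → BichromaticWalk4 colouring v₀ v₁ v₂ v₃ v₄ →
                          ¬ (IsPath4 v₀ v₁ v₂ v₃ v₄ ⊎ IsCycle4 v₀ v₁ v₂ v₃ v₄)}
              star-centre v₀
      where
      star-centre : ∀ z a v₁ v₂ v₃ v₄ → let v₀ = embed z (a , 4) in
                    BichromaticWalk4 colouring v₀ v₁ v₂ v₃ v₄ →
                    ¬ (IsPath4 v₀ v₁ v₂ v₃ v₄ ⊎ IsCycle4 v₀ v₁ v₂ v₃ v₄)
      star-centre z a v₁ v₂ v₃ v₄ (a₀₁ , a₁₂ , a₂₃ , a₃₄ , c₀₂ , c₁₃) shape =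
        proj₂ (ok z) a m₁ m₂ m₃
          (local-colours w₀ m₁ w₂ m₃ i₀ i₂ refl v₁≡ v₂≡ v₃≡ c₀₂) m₄
          (local-colours w₁ m₂ w₃ m₄ i₁ i₃ v₁≡ v₂≡ v₃≡ v₄≡ c₁₃)
          (simple4-unmap (embed z) refl v₁≡ v₂≡ v₃≡ v₄≡ (pathOrCycle⇒simple4 shape))
        where
        w₀ = (a , 4)
        i₀ = centre-inside a
        m₁ = proj₁ (lift z w₀ i₀ refl a₀₁)
        v₁≡ = proj₂ (lift z w₀ i₀ refl a₀₁)
        w₁ = step w₀ m₁
        i₁ = inside-step w₀ m₁ i₀
        m₂ = proj₁ (lift z w₁ i₁ v₁≡ a₁₂)
        v₂≡ = proj₂ (lift z w₁ i₁ v₁≡ a₁₂)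
        w₂ = step w₁ m₂
        i₂ = inside-step w₁ m₂ i₁
        m₃ = proj₁ (lift z w₂ i₂ v₂≡ a₂₃)
        v₃≡ = proj₂ (lift z w₂ i₂ v₂≡ a₂₃)
        w₃ = step w₂ m₃
        i₃ = inside-step w₂ m₃ i₂
        m₄ = proj₁ (lift z w₃ i₃ v₃≡ a₃₄)
        v₄≡ = proj₂ (lift z w₃ i₃ v₃≡ a₃₄)

    starEdgeColourable : StarEdgeColourable G k
    starEdgeColourable = colouring , proper , star

  windows-ok : ∀ {succs starts} → (∀ y → q (next y) ∈ succs (q y)) → (∀ y → q y ∈ starts) →
               All WindowOK (concatMap (paths succs 8) starts) → ∀ z → WindowOK (rowTypes 8 z)
  windows-ok {succs} next∈ start∈ ok z = All.lookup ok
    (∈-concatMap⁺ (paths succs 8) (Any.map (λ { refl → rowTypes∈paths {succs} next∈ 8 z }) (start∈ z)))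

rowType : ℕ → ℕ → ℕ
rowType D t = if does (t <? D) then t else D + t % 3

-- The row types that may follow type s when the cycle length is r modulo 3;
-- type 0 follows the last row.
successors : ℕ → ℕ → ℕ → List ℕ
successors D r s =
  if does (suc s <? D) then suc s ∷ []
  else if does (suc s ℕ.≟ D) then D + D % 3 ∷ 0 ∷ []
  else D + suc (s ∸ D) % 3 ∷ (if does (s ∸ D ℕ.≟ (r + 2) % 3) then 0 ∷ [] else [])

periodicColour : ℕ → Fin 6 → ℕ
periodicColour b j with splitAt 3 j
... | inj₁ a = (toℕ a + b) % 3
... | inj₂ a = 3 + (toℕ a + 3 ∸ b) % 3

-- S lists the colours of the D initial rows; all colours are below k.
layout : (k : ℕ) .{{_ : NonZero k}} → ℕ → List (List ℕ) → ℕ → Fin 6 → Fin k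
layout k D S s j =
  (if does (s <? D) then lookupOr 0 (lookupOr [] S s) (toℕ j) else periodicColour (s ∸ D) j) mod k

t%3≡[r+2]%3 : ∀ {t r} → suc t % 3 ≡ r → t % 3 ≡ (r + 2) % 3
t%3≡[r+2]%3 {t} {r} 1+t≡r = begin
  t % 3                 ≡⟨ [m+n]%n≡m%n t 3 ⟨
  (t + 3) % 3           ≡⟨ cong (_% 3) (+-suc t 2) ⟩
  (suc t + 2) % 3       ≡⟨ %-distribˡ-+ (suc t) 2 3 ⟩
  (suc t % 3 + 2) % 3   ≡⟨ cong (λ u → (u + 2) % 3) 1+t≡r ⟩
  (r + 2) % 3           ∎

rowType-0 : ∀ D → rowType D 0 ≡ 0
rowType-0 zero    = refl
rowType-0 (suc _) = refl

module _ {D : ℕ} where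

  rowType-< : ∀ {t} → t < D → rowType D t ≡ t
  rowType-< {t} t<D rewrite dec-true (t <? D) t<D = refl

  rowType-≥ : ∀ {t} → D ≤ t → rowType D t ≡ D + t % 3
  rowType-≥ {t} D≤t rewrite dec-false (t <? D) (≤⇒≯ D≤t) = refl

  module _ {r : ℕ} where

    successors-< : ∀ {s} → suc s < D → successors D r s ≡ suc s ∷ []
    successors-< {s} lt rewrite dec-true (suc s <? D) lt = refl

    successors-last : ∀ {s} → suc s ≡ D → successors D r s ≡ D + D % 3 ∷ 0 ∷ []
    successors-last {s} eq
      rewrite dec-false (suc s <? D) (λ lt → <⇒≢ lt eq) | dec-true (suc s ℕ.≟ D) eq = refl

    successors-periodic : ∀ j → successors D r (D + j) ≡
                          D + suc j % 3 ∷ (if does (j ℕ.≟ (r + 2) % 3) then 0 ∷ [] else [])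
    successors-periodic j
      rewrite dec-false (suc (D + j) <? D) (λ lt → ≤⇒≯ (≤-trans (m≤m+n D j) (n≤1+n _)) lt)
            | dec-false (suc (D + j) ℕ.≟ D) (λ eq → <⇒≢ (s≤s (m≤m+n D j)) (sym eq))
            | m+n∸m≡n D j = refl

    Follows : ℕ → ℕ → Set
    Follows t u = rowType D u ∈ successors D r (rowType D t)

    rowType-suc : ∀ t → Follows t (suc t)
    rowType-suc t with <-cmp (suc t) D
    ... | tri< 1+t<D _ _
      rewrite rowType-< (≤-trans (n≤1+n (suc t)) 1+t<D) | rowType-< 1+t<D | successors-< 1+t<D = here refl
    ... | tri≈ _ 1+t≡D _
      rewrite rowType-< {t} (≤-reflexive 1+t≡D) | successors-last 1+t≡D
            | rowType-≥ (≤-reflexive (sym 1+t≡D))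
      = here (cong (λ u → D + u % 3) 1+t≡D)
    ... | tri> _ _ D<1+t
      rewrite rowType-≥ (s≤s⁻¹ D<1+t) | rowType-≥ (≤-trans (s≤s⁻¹ D<1+t) (n≤1+n t))
            | successors-periodic (t % 3)
      = here (cong (D +_) (sym ([1+m%n]%n≡[1+m]%n t 3)))

    rowType-last : ∀ {t} → suc t % 3 ≡ r → D ≤ suc t → Follows t 0
    rowType-last {t} 1+t≡r D≤1+t rewrite rowType-0 D with t <? D
    ... | yes t<D rewrite rowType-< t<D | successors-last (≤-antisym t<D D≤1+t) = there (here refl)
    ... | no t≮D
      rewrite rowType-≥ (≮⇒≥ t≮D) | successors-periodic (t % 3)
            | dec-true (t % 3 ℕ.≟ (r + 2) % 3) (t%3≡[r+2]%3 {t} 1+t≡r) = there (here refl)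

    rowType-next : ∀ {m} → suc m % 3 ≡ r → D ≤ suc m →
                   ∀ (y : Fin (suc m)) → Follows (toℕ y) (toℕ (Rotation.next m y))
    rowType-next {m} N≡r D≤N y with Rotation.succ-next m y
    ... | inj₁ 1+y≡next = subst (Follows (toℕ y)) 1+y≡next (rowType-suc (toℕ y))
    ... | inj₂ (1+y≡N , next≡0) =
      subst (Follows (toℕ y)) (sym next≡0)
        (rowType-last (trans (cong (_% 3) 1+y≡N) N≡r) (subst (D ≤_) (sym 1+y≡N) D≤N))

rowType∈upTo : ∀ D t → rowType D t ∈ upTo (D + 3)
rowType∈upTo D t with t <? D
... | yes t<D rewrite rowType-< t<D = ∈-upTo⁺ (≤-trans t<D (m≤m+n D 3))
... | no t≮D rewrite rowType-≥ {D} (≮⇒≥ t≮D) = ∈-upTo⁺ (+-monoʳ-< D (m%n<n t 3))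

-- Every sequence of types of nine consecutive rows occurs here.
windowTypes : ℕ → ℕ → List (List ℕ)
windowTypes D r = concatMap (paths (successors D r) 8) (upTo (D + 3))

patternColourable : ∀ k .{{_ : NonZero k}} D r S →
                    All (WindowCheck.WindowOK (layout k D S)) (windowTypes D r) →
                    ∀ m h → suc m % 3 ≡ r → D ≤ suc m → StarEdgeColourable (Torus₃ m h) k
patternColourable k D r S windows m h N≡r D≤N =
  starEdgeColourable
    (windows-ok {successors D r} (rowType-next N≡r D≤N) (λ y → rowType∈upTo D (toℕ y)) windows)
  where open RowColouring m h (layout k D S) (λ y → rowType D (toℕ y))

initialRows₄ : List (List ℕ)
initialRows₄ =
    (1 ∷ 2 ∷ 0 ∷ 5 ∷ 3 ∷ 4 ∷ [])
  ∷ (2 ∷ 0 ∷ 6 ∷ 1 ∷ 6 ∷ 5 ∷ [])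
  ∷ (4 ∷ 3 ∷ 0 ∷ 6 ∷ 5 ∷ 2 ∷ [])
  ∷ (0 ∷ 1 ∷ 5 ∷ 3 ∷ 4 ∷ 6 ∷ [])
  ∷ []

initialRows₅ : List (List ℕ)
initialRows₅ =
    (2 ∷ 0 ∷ 1 ∷ 4 ∷ 5 ∷ 3 ∷ [])
  ∷ (0 ∷ 1 ∷ 2 ∷ 3 ∷ 4 ∷ 6 ∷ [])
  ∷ (1 ∷ 2 ∷ 0 ∷ 6 ∷ 5 ∷ 1 ∷ [])
  ∷ (2 ∷ 3 ∷ 4 ∷ 3 ∷ 6 ∷ 5 ∷ [])
  ∷ (1 ∷ 4 ∷ 0 ∷ 5 ∷ 3 ∷ 6 ∷ [])
  ∷ []

windows₀ : All (WindowCheck.WindowOK (layout 6 0 [])) (windowTypes 0 0)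
windows₀ = from-yes (All.all? (WindowCheck.windowOK? (layout 6 0 [])) (windowTypes 0 0))

windows₁ : All (WindowCheck.WindowOK (layout 7 4 initialRows₄)) (windowTypes 4 1)
windows₁ = from-yes (All.all? (WindowCheck.windowOK? (layout 7 4 initialRows₄)) (windowTypes 4 1))

windows₂ : All (WindowCheck.WindowOK (layout 7 5 initialRows₅)) (windowTypes 5 2)
windows₂ = from-yes (All.all? (WindowCheck.windowOK? (layout 7 5 initialRows₅)) (windowTypes 5 2))

seven-colourable : ∀ m h → ¬ 3 ∣ suc m → StarEdgeColourable (Torus₃ m h) 7
seven-colourable m h 3∤N with suc m % 3 in N%3 | m%n<n (suc m) 3
... | 0 | _ = ⊥-elim (3∤N (m%n≡0⇒n∣m (suc m) 3 N%3))
... | 1 | _ = patternColourable 7 4 1 initialRows₄ windows₁ m h N%3 (3∤n⇒4≤n h 3∤N)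
... | 2 | _ = patternColourable 7 5 2 initialRows₅ windows₂ m h N%3 (≤∧≢⇒< (3∤n⇒4≤n h 3∤N) 4≢N)
  where
  4≢N : 4 ≢ suc m
  4≢N 4≡N with () ← subst (λ n → n % 3 ≡ 2) (sym 4≡N) N%3
... | suc (suc (suc _)) | s≤s (s≤s (s≤s ()))

theorem11 : (n : ℕ) (h : 3 ≤ n) →
    (3 ∣ n → StarChromaticIndex≡ (Cycle 3 (s≤s (s≤s (s≤s z≤n))) □ Cycle n h) 6) ×
    (¬ (3 ∣ n) → StarChromaticIndex≡ (Cycle 3 (s≤s (s≤s (s≤s z≤n))) □ Cycle n h) 7)
theorem11 (suc m) h = divisible , indivisible
  where
  divisible : 3 ∣ suc m → StarChromaticIndex≡ (Torus₃ m h) 6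
  divisible 3∣N = patternColourable 6 0 0 [] windows₀ m h (n∣m⇒m%n≡0 (suc m) 3 3∣N) z≤n ,
                  λ k k<6 → no-5-colouring m h ∘ starEdgeColourable-mono (s≤s⁻¹ k<6)
  indivisible : ¬ 3 ∣ suc m → StarChromaticIndex≡ (Torus₃ m h) 7
  indivisible 3∤N = seven-colourable m h 3∤N ,
                    λ k k<7 → no-6-colouring m h 3∤N ∘ starEdgeColourable-mono (s≤s⁻¹ k<7)
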